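{- Let $G$ be a finite simple connected graph with at least three vertices. Every edge-locating coloring of $G$ is an edge distinguishing coloring of $G$.
   Context: For a proper edge coloring $c:E(G)\to\{1,\dots,k\}$ of $G$, let $\pi=(\mathcal{C}_1,\dots,\mathcal{C}_k)$ be the ordered partition of $E(G)$ into color classes. For a vertex $v$ and an edge $e=xy$, $d(v,e)=\min\{d(v,x),d(v,y)\}$, and $d(v,\mathcal{C}_i)=\min\{d(v,e): e\in\mathcal{C}_i\}$. The edge color code of $v$ is $c_\pi(v)=(d(v,\mathcal{C}_1),\dots,d(v,\mathcal{C}_k))$. The coloring $c$ is an edge-locating coloring if distinct vertices have distinct edge color codes. An automorphism $f$ of $G$ acts on edges by $f(xy)=f(x)f(y)$; $f$ preserves $c$ if $c(f(e))=c(e)$ for every edge $e$. An edge distinguishing coloring is a proper edge coloring such that the only automorphism of $G$ preserving it is the identity. -}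

module Defs where

open import Data.Nat using (ℕ; zero; suc; _≤_; _⊓_)
open import Data.Fin using (Fin)
open import Data.Bool using (Bool; true; false; T)
open import Data.Product using (Σ; ∃; ∃-syntax; _×_; _,_)
open import Data.Fin.Permutation using (Permutation′; _⟨$⟩ʳ_)
open import Relation.Binary.PropositionalEquality using (_≡_; _≢_)
open import Relation.Nullary using (¬_)
open import Function.Bundles using (_⇔_)

record SimpleGraph (n : ℕ) : Set where
  field
    adj     : Fin n → Fin n → Bool
    sym     : ∀ x y → adj x y ≡ adj y x
    irrefl  : ∀ x → adj x x ≡ false

module _ {n : ℕ} (G : SimpleGraph n) where
  open SimpleGraph G

  Adj : Fin n → Fin n → Set
  Adj x y = T (adj x y)

  data Walk : Fin n → Fin n → ℕ → Set where
    here : ∀ {u} → Walk u u zero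
    step : ∀ {u w v ℓ} → Adj u w → Walk w v ℓ → Walk u v (suc ℓ)

  Connected : Set
  Connected = ∀ u v → ∃[ ℓ ] Walk u v ℓ

  Dist : Fin n → Fin n → ℕ → Set
  Dist u v d = Walk u v d × (∀ ℓ → Walk u v ℓ → d ≤ ℓ)

  IsAutomorphism : Permutation′ n → Set
  IsAutomorphism f = ∀ x y → Adj x y ⇔ Adj (f ⟨$⟩ʳ x) (f ⟨$⟩ʳ y)

  -- A proper edge coloring with colors Fin k (i.e. {1,…,k}), all colors used
  -- (so that π = (C₁,…,C_k) is an ordered partition of E(G) into k classes).
  record ProperEdgeColoring (k : ℕ) : Set where
    field
      col       : (x y : Fin n) → Adj x y → Fin k
      col-sym   : ∀ x y (p : Adj x y) (q : Adj y x) → col x y p ≡ col y x q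
      proper    : ∀ x y z (p : Adj x y) (q : Adj x z) → y ≢ z → col x y p ≢ col x z q
      surjective : ∀ (i : Fin k) → ∃[ x ] ∃[ y ] Σ (Adj x y) λ p → col x y p ≡ i

  module _ {k : ℕ} (c : ProperEdgeColoring k) where
    open ProperEdgeColoring c

    DistEdge : Fin n → Fin n → Fin n → ℕ → Set
    DistEdge v x y m = ∃[ dx ] ∃[ dy ] (Dist v x dx × Dist v y dy × m ≡ dx ⊓ dy)

    DistClass : Fin n → Fin k → ℕ → Set
    DistClass v i m =
      (∃[ x ] ∃[ y ] Σ (Adj x y) λ p → col x y p ≡ i × DistEdge v x y m)
      × (∀ x y (p : Adj x y) → col x y p ≡ i → ∀ m′ → DistEdge v x y m′ → m ≤ m′)

    SameCode : Fin n → Fin n → Set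
    SameCode u v = ∀ (i : Fin k) (m : ℕ) → DistClass u i m ⇔ DistClass v i m

    IsEdgeLocating : Set
    IsEdgeLocating = ∀ u v → u ≢ v → ¬ SameCode u v

    Preserves : Permutation′ n → Set
    Preserves f = ∀ x y (p : Adj x y) (q : Adj (f ⟨$⟩ʳ x) (f ⟨$⟩ʳ y)) →
                  col (f ⟨$⟩ʳ x) (f ⟨$⟩ʳ y) q ≡ col x y p

    IsEdgeDistinguishing : Set
    IsEdgeDistinguishing =
      ∀ (f : Permutation′ n) → IsAutomorphism f → Preserves f → ∀ x → f ⟨$⟩ʳ x ≡ x

{-# OPTIONS --safe #-}
module Submission where

open import Defs
open import Data.Nat using (ℕ; _≤_)
open import Data.Fin using (Fin; _≟_)
open import Data.Bool.Properties using (T-irrelevant)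
open import Data.Product using (_,_)
open import Data.Fin.Permutation using (Permutation′; _⟨$⟩ʳ_; _⟨$⟩ˡ_; flip; inverseˡ; inverseʳ)
open import Function.Base using (_∘_)
open import Function.Bundles using (Equivalence; mk⇔)
open import Relation.Binary.PropositionalEquality using (_≡_; refl; sym; trans; cong; subst; subst₂)
open import Relation.Nullary.Decidable using (decidable-stable)

-- A colour-preserving automorphism f preserves all distances, hence every
-- edge colour code: c_π(f v) = c_π(v). An edge-locating colouring therefore
-- forces f v = v.

module _ {n : ℕ} (G : SimpleGraph n) where

  Walk-map : {f : Fin n → Fin n} → (∀ {a b} → Adj G a b → Adj G (f a) (f b)) →
             ∀ {u v ℓ} → Walk G u v ℓ → Walk G (f u) (f v) ℓ
  Walk-map f-adj here         = here
  Walk-map f-adj (step uw wv) = step (f-adj uw) (Walk-map f-adj wv)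

  Adj-preserved : (f : Permutation′ n) → IsAutomorphism G f →
                  ∀ {a b} → Adj G a b → Adj G (f ⟨$⟩ʳ a) (f ⟨$⟩ʳ b)
  Adj-preserved f aut = Equivalence.to (aut _ _)

  flip-isAutomorphism : (f : Permutation′ n) → IsAutomorphism G f → IsAutomorphism G (flip f)
  flip-isAutomorphism f aut a b = mk⇔
    (Equivalence.from (aut _ _) ∘ subst₂ (Adj G) (sym (inverseʳ f)) (sym (inverseʳ f)))
    (subst₂ (Adj G) (inverseʳ f) (inverseʳ f) ∘ Equivalence.to (aut _ _))

  Walk-reflected : (f : Permutation′ n) → IsAutomorphism G f →
                   ∀ {u v ℓ} → Walk G (f ⟨$⟩ʳ u) (f ⟨$⟩ʳ v) ℓ → Walk G u v ℓ
  Walk-reflected f aut {ℓ = ℓ} =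
    subst₂ (λ a b → Walk G a b ℓ) (inverseˡ f) (inverseˡ f)
      ∘ Walk-map (Adj-preserved (flip f) (flip-isAutomorphism f aut))

  Dist-preserved : (f : Permutation′ n) → IsAutomorphism G f →
                   ∀ {u v d} → Dist G u v d → Dist G (f ⟨$⟩ʳ u) (f ⟨$⟩ʳ v) d
  Dist-preserved f aut (w , shortest) =
    Walk-map (Adj-preserved f aut) w , λ ℓ w′ → shortest ℓ (Walk-reflected f aut w′)

  module _ {k : ℕ} (c : ProperEdgeColoring G k) where
    open ProperEdgeColoring c

    col-cong : ∀ {x x′ y y′} (p : Adj G x y) (p′ : Adj G x′ y′) →
               x ≡ x′ → y ≡ y′ → col x y p ≡ col x′ y′ p′
    col-cong p p′ refl refl = cong (col _ _) (T-irrelevant p p′)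

    flip-preserves : (f : Permutation′ n) → IsAutomorphism G f →
                     Preserves G c f → Preserves G c (flip f)
    flip-preserves f aut pres x y p q = trans
      (sym (pres _ _ q (Adj-preserved f aut q)))
      (col-cong _ p (inverseʳ f) (inverseʳ f))

    DistEdge-preserved : (f : Permutation′ n) → IsAutomorphism G f →
                         ∀ {v x y m} → DistEdge G c v x y m →
                         DistEdge G c (f ⟨$⟩ʳ v) (f ⟨$⟩ʳ x) (f ⟨$⟩ʳ y) m
    DistEdge-preserved f aut (dx , dy , vx , vy , m≡) =
      dx , dy , Dist-preserved f aut vx , Dist-preserved f aut vy , m≡

    DistEdge-pulledBack : (f : Permutation′ n) → IsAutomorphism G f →
                          ∀ {v x y m} → DistEdge G c (f ⟨$⟩ʳ v) x y m →
                          DistEdge G c v (f ⟨$⟩ˡ x) (f ⟨$⟩ˡ y) m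
    DistEdge-pulledBack f aut {v} {x} {y} {m} =
      subst (λ u → DistEdge G c u (f ⟨$⟩ˡ x) (f ⟨$⟩ˡ y) m) (inverseˡ f)
        ∘ DistEdge-preserved (flip f) (flip-isAutomorphism f aut)

    -- The minimality half is transported backwards along f⁻¹.
    DistClass-preserved : (f : Permutation′ n) → IsAutomorphism G f → Preserves G c f →
                          ∀ {v i m} → DistClass G c v i m → DistClass G c (f ⟨$⟩ʳ v) i m
    DistClass-preserved f aut pres ((x , y , p , colᵢ , e) , minimal) =
      (_ , _ , Adj-preserved f aut p , trans (pres x y p _) colᵢ , DistEdge-preserved f aut e) ,
      λ x′ y′ p′ colᵢ′ m′ e′ →
        let p″ = Adj-preserved (flip f) (flip-isAutomorphism f aut) p′ in
        minimal _ _ p″ (trans (flip-preserves f aut pres x′ y′ p′ p″) colᵢ′) m′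
                (DistEdge-pulledBack f aut e′)

    SameCode-automorphism : (f : Permutation′ n) → IsAutomorphism G f → Preserves G c f →
                            ∀ v → SameCode G c v (f ⟨$⟩ʳ v)
    SameCode-automorphism f aut pres v i m = mk⇔
      (DistClass-preserved f aut pres)
      (subst (λ u → DistClass G c u i m) (inverseˡ f)
         ∘ DistClass-preserved (flip f) (flip-isAutomorphism f aut) (flip-preserves f aut pres))

theorem24 : (n : ℕ) → 3 ≤ n → (G : SimpleGraph n) → Connected G →
    (k : ℕ) → (c : ProperEdgeColoring G k) →
    IsEdgeLocating G c → IsEdgeDistinguishing G c
theorem24 n _ G _ k c locating f aut pres x =
  decidable-stable (f ⟨$⟩ʳ x ≟ x) λ fx≢x →
    locating x (f ⟨$⟩ʳ x) (fx≢x ∘ sym) (SameCode-automorphism G c f aut pres x)
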